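{- For every $n\ge 1$, the number of idempotents in the set ${\cal OCT}_n$ of order-preserving full contractions of $X_n=\{1,\dots,n\}$ is $|E({\cal OCT}_n)|=n(n+1)/2=\binom{n+1}{2}$.
   Context: Full transformations are maps $\alpha:X_n\to X_n$; $\alpha$ is idempotent if $\alpha\circ\alpha=\alpha$. Order-preserving: $x\le y\Rightarrow x\alpha\le y\alpha$. Contraction: $|x\alpha-y\alpha|\le|x-y|$ for all $x,y$. -}

module Defs where

open import Data.Nat using (ℕ; _≤_; _∸_)
open import Data.Fin using (Fin; toℕ)
open import Data.Vec using (Vec; lookup)
open import Data.Product using (Σ; _×_)
open import Relation.Binary.PropositionalEquality using (_≡_)

-- A full transformation of X_n = {1,…,n}, represented by its table of
-- values: element i (0-based, Fin n) is mapped to  lookup α i.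
Transformation : ℕ → Set
Transformation n = Vec (Fin n) n

app : ∀ {n} → Transformation n → Fin n → Fin n
app α x = lookup α x

dist : ℕ → ℕ → ℕ
dist a b = (a ∸ b) Data.Nat.+ (b ∸ a)

IsIdempotent : ∀ {n} → Transformation n → Set
IsIdempotent {n} α = ∀ (x : Fin n) → app α (app α x) ≡ app α x

IsOrderPreserving : ∀ {n} → Transformation n → Set
IsOrderPreserving {n} α =
  ∀ (x y : Fin n) → toℕ x ≤ toℕ y → toℕ (app α x) ≤ toℕ (app α y)

IsContraction : ∀ {n} → Transformation n → Set
IsContraction {n} α =
  ∀ (x y : Fin n) → dist (toℕ (app α x)) (toℕ (app α y)) ≤ dist (toℕ x) (toℕ y)

InOCT : ∀ {n} → Transformation n → Set
InOCT α = IsOrderPreserving α × IsContraction α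

E-OCT : ℕ → Set
E-OCT n = Σ (Transformation n) (λ α → InOCT α × IsIdempotent α)

open import Data.Product using (proj₁; ∃)

-- |E(OCT_n)| = k : there is a bijection between E(OCT_n) and Fin k, where
-- two elements of E(OCT_n) are identified when they are the same
-- transformation (the proof components are irrelevant; this avoids needing
-- function extensionality for the ∀-shaped membership proofs).
HasSize : ℕ → ℕ → Set
HasSize n k =
  Σ (E-OCT n → Fin k) λ f →
    (∀ a b → f a ≡ f b → proj₁ a ≡ proj₁ b) ×
    (∀ (i : Fin k) → ∃ λ a → f a ≡ i)

module Submission where

-- Let α be an idempotent order-preserving contraction and put
-- a = α(0), b = α(n-1), so a ≤ b ≤ n-1.  Monotonicity forces α to be
-- constant a below a and constant b above b (α fixes a and b, being
-- idempotent), and on [a,b] the contraction property against the fixed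
-- points a and b gives both α(x) ≤ x and x ≤ α(x).  Hence α is the clamp
-- x ↦ a ⊔ (x ⊓ b).  Conversely every clamp with a ≤ b < n is an idempotent
-- order-preserving contraction with endpoints a and b.  So E(OCT_n) is in
-- bijection with the pairs a ≤ b < n, and these are counted by the
-- triangular number T n = n(n+1)/2 through the code (a,b) ↦ a + T b.

open import Defs
open import Data.Nat using (ℕ; suc; _*_; _/_; _≤_)
open import Data.Nat using (zero; _+_; _∸_; _<_; _⊔_; _⊓_; z≤n; s≤s; s≤s⁻¹)
open import Data.Nat.Properties
open import Data.Nat.DivMod using (m*n/n≡m)
open import Data.Nat.Tactic.RingSolver using (solve-∀)
open import Data.Fin as Fin using (Fin; toℕ; fromℕ<; fromℕ)
open import Data.Fin.Properties using (toℕ-injective; toℕ<n; toℕ-fromℕ<; toℕ-fromℕ)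
open import Data.Vec using (lookup; tabulate)
open import Data.Vec.Properties using (tabulate∘lookup; tabulate-cong; lookup∘tabulate)
open import Data.Product using (Σ; _×_; _,_; proj₁; proj₂; ∃)
open import Data.Sum using (inj₁; inj₂)
open import Data.Empty using (⊥-elim)
open import Relation.Nullary using (yes; no)
open import Relation.Binary using (tri<; tri≈; tri>)
open import Relation.Binary.PropositionalEquality

T : ℕ → ℕ
T zero = 0
T (suc b) = suc b + T b

gauss-step : ∀ n → suc n * suc (suc n) ≡ suc n * 2 + n * suc n
gauss-step = solve-∀

n*[1+n]≡T*2 : ∀ n → n * suc n ≡ T n * 2
n*[1+n]≡T*2 zero = refl
n*[1+n]≡T*2 (suc n) = begin
    suc n * suc (suc n)    ≡⟨ gauss-step n ⟩
    suc n * 2 + n * suc n  ≡⟨ cong (suc n * 2 +_) (n*[1+n]≡T*2 n) ⟩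
    suc n * 2 + T n * 2    ≡⟨ *-distribʳ-+ 2 (suc n) (T n) ⟨
    T (suc n) * 2          ∎
  where open ≡-Reasoning

n*[1+n]/2≡T : ∀ n → n * suc n / 2 ≡ T n
n*[1+n]/2≡T n = trans (cong (_/ 2) (n*[1+n]≡T*2 n)) (m*n/n≡m (T n) 2)

T-mono : ∀ {m n} → m ≤ n → T m ≤ T n
T-mono {m} {zero} z≤n = z≤n
T-mono {m} {suc n} m≤1+n with m≤n⇒m<n∨m≡n m≤1+n
... | inj₁ m<1+n = ≤-trans (T-mono (s≤s⁻¹ m<1+n)) (m≤n+m (T n) (suc n))
... | inj₂ refl  = ≤-refl

-- The code of a pair a ≤ b.  Pairs with second component b occupy exactly
-- the block [T b, T (b+1)), so the pairs a ≤ b < n fill [0, T n) bijectively.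
code : ℕ → ℕ → ℕ
code a b = a + T b

code<T[1+b] : ∀ {a b} → a ≤ b → code a b < T (suc b)
code<T[1+b] {a} {b} a≤b = +-monoˡ-≤ (T b) (s≤s a≤b)

code<T : ∀ {a b n} → a ≤ b → b < n → code a b < T n
code<T a≤b b<n = ≤-trans (code<T[1+b] a≤b) (T-mono b<n)

code-increasing : ∀ {a b a′ b′} → a ≤ b → b < b′ → code a b < code a′ b′
code-increasing {a′ = a′} {b′} a≤b b<b′ =
  ≤-trans (code<T a≤b b<b′) (m≤n+m (T b′) a′)

code-injective : ∀ {a b a′ b′} → a ≤ b → a′ ≤ b′ →
                 code a b ≡ code a′ b′ → a ≡ a′ × b ≡ b′
code-injective {a} {b} {a′} {b′} a≤b a′≤b′ eq with <-cmp b b′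
... | tri< b<b′ _ _ = ⊥-elim (<-irrefl eq (code-increasing a≤b b<b′))
... | tri> _ _ b′<b = ⊥-elim (<-irrefl (sym eq) (code-increasing a′≤b′ b′<b))
... | tri≈ _ refl _ = +-cancelʳ-≡ (T b) a a′ eq , refl

decode : ∀ n i → i < T n →
         Σ ℕ λ a → Σ ℕ λ b → a ≤ b × b < n × code a b ≡ i
decode (suc n) i i<T[1+n] with i <? T n
... | yes i<Tn =
  let (a , b , a≤b , b<n , eq) = decode n i i<Tn
  in a , b , a≤b , m<n⇒m<1+n b<n , eq
... | no i≮Tn = i ∸ T n , n , s≤s⁻¹ i∸Tn<1+n , ≤-refl , m∸n+n≡m Tn≤i
  where
  Tn≤i : T n ≤ i
  Tn≤i = ≮⇒≥ i≮Tn
  i∸Tn<1+n : i ∸ T n < suc n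
  i∸Tn<1+n = subst (i ∸ T n <_) (m+n∸n≡m (suc n) (T n)) (∸-monoˡ-< i<T[1+n] Tn≤i)

dist-≤ : ∀ {u v} → u ≤ v → dist u v ≡ v ∸ u
dist-≤ {u} {v} u≤v = cong (_+ (v ∸ u)) (m≤n⇒m∸n≡0 u≤v)

dist-≥ : ∀ {u v} → v ≤ u → dist u v ≡ u ∸ v
dist-≥ {u} {v} v≤u = trans (cong ((u ∸ v) +_) (m≤n⇒m∸n≡0 v≤u)) (+-identityʳ _)

monotone-1-Lipschitz⇒contraction :
  (g : ℕ → ℕ) → (∀ {x y} → x ≤ y → g x ≤ g y) →
  (∀ {x y} → x ≤ y → g y ≤ g x + (y ∸ x)) →
  ∀ x y → dist (g x) (g y) ≤ dist x y
monotone-1-Lipschitz⇒contraction g mono lip x y with ≤-total x y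
... | inj₁ x≤y = subst₂ _≤_ (sym (dist-≤ (mono x≤y))) (sym (dist-≤ x≤y))
                   (m≤n+o⇒m∸n≤o (g y) (g x) (lip x≤y))
... | inj₂ y≤x = subst₂ _≤_ (sym (dist-≥ (mono y≤x))) (sym (dist-≥ y≤x))
                   (m≤n+o⇒m∸n≤o (g x) (g y) (lip y≤x))

module Clamp (a b : ℕ) (a≤b : a ≤ b) where

  clamp : ℕ → ℕ
  clamp x = a ⊔ (x ⊓ b)

  clamp≤b : ∀ x → clamp x ≤ b
  clamp≤b x = ⊔-lub a≤b (m⊓n≤n x b)

  a≤clamp : ∀ x → a ≤ clamp x
  a≤clamp x = m≤m⊔n a (x ⊓ b)

  clamp-below : ∀ {x} → x ≤ a → clamp x ≡ a
  clamp-below x≤a = trans (cong (a ⊔_) (m≤n⇒m⊓n≡m (≤-trans x≤a a≤b))) (m≥n⇒m⊔n≡m x≤a)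

  clamp-above : ∀ {x} → b ≤ x → clamp x ≡ b
  clamp-above b≤x = trans (cong (a ⊔_) (m≥n⇒m⊓n≡n b≤x)) (m≤n⇒m⊔n≡n a≤b)

  clamp-between : ∀ {x} → a ≤ x → x ≤ b → clamp x ≡ x
  clamp-between a≤x x≤b = trans (cong (a ⊔_) (m≤n⇒m⊓n≡m x≤b)) (m≤n⇒m⊔n≡n a≤x)

  clamp-idempotent : ∀ x → clamp (clamp x) ≡ clamp x
  clamp-idempotent x = clamp-between (a≤clamp x) (clamp≤b x)

  clamp-mono : ∀ {x y} → x ≤ y → clamp x ≤ clamp y
  clamp-mono x≤y = ⊔-monoʳ-≤ a (⊓-monoˡ-≤ b x≤y)

  -- Translating x, a and b by d = y ∸ x bounds clamp y by clamp x + d.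
  clamp-lip : ∀ {x y} → x ≤ y → clamp y ≤ clamp x + (y ∸ x)
  clamp-lip {x} {y} x≤y = subst (clamp y ≤_) (sym shift)
    (⊔-mono-≤ (m≤m+n a d) (⊓-mono-≤ (≤-reflexive (sym (m+[n∸m]≡n x≤y))) (m≤m+n b d)))
    where
    d : ℕ
    d = y ∸ x
    shift : clamp x + d ≡ (a + d) ⊔ ((x + d) ⊓ (b + d))
    shift = trans (+-distribʳ-⊔ d a (x ⊓ b)) (cong ((a + d) ⊔_) (+-distribʳ-⊓ d x b))

  clamp-contraction : ∀ x y → dist (clamp x) (clamp y) ≤ dist x y
  clamp-contraction = monotone-1-Lipschitz⇒contraction clamp clamp-mono clamp-lip

lastℕ : ∀ {m} (x : Fin (suc m)) → toℕ x ≤ toℕ (fromℕ m)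
lastℕ {m} x = subst (toℕ x ≤_) (sym (toℕ-fromℕ m)) (s≤s⁻¹ (toℕ<n x))

module Endpoints {m : ℕ} (α : Transformation (suc m)) (order : IsOrderPreserving α)
                 (contraction : IsContraction α) (idempotent : IsIdempotent α) where

  α̂ : Fin (suc m) → ℕ
  α̂ x = toℕ (app α x)

  p q : Fin (suc m)
  p = app α Fin.zero
  q = app α (fromℕ m)

  lo hi : ℕ
  lo = toℕ p
  hi = toℕ q

  α̂p≡lo : α̂ p ≡ lo
  α̂p≡lo = cong toℕ (idempotent Fin.zero)

  α̂q≡hi : α̂ q ≡ hi
  α̂q≡hi = cong toℕ (idempotent (fromℕ m))

  lo≤α̂ : ∀ x → lo ≤ α̂ x
  lo≤α̂ x = order Fin.zero x z≤n

  α̂≤hi : ∀ x → α̂ x ≤ hi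
  α̂≤hi x = order x (fromℕ m) (lastℕ x)

  lo≤hi : lo ≤ hi
  lo≤hi = lo≤α̂ (fromℕ m)

  open Clamp lo hi lo≤hi

  -- below lo, monotonicity squeezes α̂ x between lo and α̂ p = lo
  below : ∀ {x} → toℕ x ≤ lo → α̂ x ≡ lo
  below {x} x≤lo = ≤-antisym (subst (α̂ x ≤_) α̂p≡lo (order x p x≤lo)) (lo≤α̂ x)

  -- symmetrically, above hi it is squeezed between α̂ q = hi and hi
  above : ∀ {x} → hi ≤ toℕ x → α̂ x ≡ hi
  above {x} hi≤x = ≤-antisym (α̂≤hi x) (subst (_≤ α̂ x) α̂q≡hi (order q x hi≤x))

  -- inside [lo, hi], contracting towards the fixed points p and q pins α̂ x to x
  between : ∀ {x} → lo ≤ toℕ x → toℕ x ≤ hi → α̂ x ≡ toℕ x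
  between {x} lo≤x x≤hi = ≤-antisym α̂x≤x x≤α̂x
    where
    from-lo : α̂ x ∸ lo ≤ toℕ x ∸ lo
    from-lo = subst₂ _≤_ (trans (cong (dist (α̂ x)) α̂p≡lo) (dist-≥ (lo≤α̂ x)))
                         (dist-≥ lo≤x) (contraction x p)
    α̂x≤x : α̂ x ≤ toℕ x
    α̂x≤x = subst₂ _≤_ (m∸n+n≡m (lo≤α̂ x)) (m∸n+n≡m lo≤x) (+-monoˡ-≤ lo from-lo)
    to-hi : hi ∸ α̂ x ≤ hi ∸ toℕ x
    to-hi = subst₂ _≤_ (trans (cong (dist (α̂ x)) α̂q≡hi) (dist-≤ (α̂≤hi x)))
                       (dist-≤ x≤hi) (contraction x q)
    x≤α̂x : toℕ x ≤ α̂ x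
    x≤α̂x = ∸-cancelʳ-≤ x≤hi to-hi

  is-clamp : ∀ x → α̂ x ≡ clamp (toℕ x)
  is-clamp x with toℕ x ≤? lo | hi ≤? toℕ x
  ... | yes x≤lo | _         = trans (below x≤lo) (sym (clamp-below x≤lo))
  ... | no _     | yes hi≤x  = trans (above hi≤x) (sym (clamp-above hi≤x))
  ... | no x≰lo  | no hi≰x   = trans (between lo≤x x≤hi) (sym (clamp-between lo≤x x≤hi))
    where
    lo≤x : lo ≤ toℕ x
    lo≤x = <⇒≤ (≰⇒> x≰lo)
    x≤hi : toℕ x ≤ hi
    x≤hi = <⇒≤ (≰⇒> hi≰x)

module ClampMap (m a b : ℕ) (a≤b : a ≤ b) (b<1+m : b < suc m) where
  open Clamp a b a≤b

  clampFin : Fin (suc m) → Fin (suc m)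
  clampFin x = fromℕ< (≤-trans (s≤s (clamp≤b (toℕ x))) b<1+m)

  clampMap : Transformation (suc m)
  clampMap = tabulate clampFin

  app-clampMap : ∀ x → toℕ (app clampMap x) ≡ clamp (toℕ x)
  app-clampMap x = trans (cong toℕ (lookup∘tabulate clampFin x)) (toℕ-fromℕ< _)

  order : IsOrderPreserving clampMap
  order x y x≤y = subst₂ _≤_ (sym (app-clampMap x)) (sym (app-clampMap y)) (clamp-mono x≤y)

  contraction : IsContraction clampMap
  contraction x y = subst₂ (λ u v → dist u v ≤ dist (toℕ x) (toℕ y))
                      (sym (app-clampMap x)) (sym (app-clampMap y))
                      (clamp-contraction (toℕ x) (toℕ y))

  idempotent : IsIdempotent clampMap
  idempotent x = toℕ-injective (begin
    toℕ (app clampMap (app clampMap x))  ≡⟨ app-clampMap (app clampMap x) ⟩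
    clamp (toℕ (app clampMap x))         ≡⟨ cong clamp (app-clampMap x) ⟩
    clamp (clamp (toℕ x))                ≡⟨ clamp-idempotent (toℕ x) ⟩
    clamp (toℕ x)                        ≡⟨ app-clampMap x ⟨
    toℕ (app clampMap x)                 ∎)
    where open ≡-Reasoning

  element : E-OCT (suc m)
  element = clampMap , (order , contraction) , idempotent

  open Endpoints clampMap order contraction idempotent using (lo; hi)

  lo≡a : lo ≡ a
  lo≡a = trans (app-clampMap Fin.zero) (clamp-below z≤n)

  hi≡b : hi ≡ b
  hi≡b = trans (app-clampMap (fromℕ m))
               (clamp-above (subst (b ≤_) (sym (toℕ-fromℕ m)) (s≤s⁻¹ b<1+m)))

lookup-extensionality : ∀ {n} (α β : Transformation n) →
                        (∀ x → lookup α x ≡ lookup β x) → α ≡ β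
lookup-extensionality α β α≗β =
  trans (sym (tabulate∘lookup α)) (trans (tabulate-cong α≗β) (tabulate∘lookup β))

module Count (m : ℕ) where

  endpointCode : E-OCT (suc m) → Fin (T (suc m))
  endpointCode (α , (order , contraction) , idempotent) =
    fromℕ< (code<T lo≤hi (toℕ<n q))
    where open Endpoints α order contraction idempotent

  -- an idempotent is determined by its endpoints, and these by their code
  endpointCode-injective : ∀ e e′ → endpointCode e ≡ endpointCode e′ → proj₁ e ≡ proj₁ e′
  endpointCode-injective (α , (o , c) , i) (β , (o′ , c′) , i′) eq =
    lookup-extensionality α β λ x → toℕ-injective (begin
      toℕ (app α x)              ≡⟨ E.is-clamp x ⟩
      E.lo ⊔ (toℕ x ⊓ E.hi)      ≡⟨ cong₂ (λ a b → a ⊔ (toℕ x ⊓ b)) same-lo same-hi ⟩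
      E′.lo ⊔ (toℕ x ⊓ E′.hi)    ≡⟨ E′.is-clamp x ⟨
      toℕ (app β x)              ∎)
    where
    module E = Endpoints α o c i
    module E′ = Endpoints β o′ c′ i′
    open ≡-Reasoning
    same-codes : code E.lo E.hi ≡ code E′.lo E′.hi
    same-codes = trans (sym (toℕ-fromℕ< _)) (trans (cong toℕ eq) (toℕ-fromℕ< _))
    same-lo : E.lo ≡ E′.lo
    same-lo = proj₁ (code-injective E.lo≤hi E′.lo≤hi same-codes)
    same-hi : E.hi ≡ E′.hi
    same-hi = proj₂ (code-injective E.lo≤hi E′.lo≤hi same-codes)

  endpointCode-surjective : ∀ i → ∃ λ e → endpointCode e ≡ i
  endpointCode-surjective i with decode (suc m) (toℕ i) (toℕ<n i)
  ... | a , b , a≤b , b<1+m , code≡i = element , toℕ-injective (begin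
      toℕ (endpointCode element)  ≡⟨ toℕ-fromℕ< _ ⟩
      code lo hi                  ≡⟨ cong₂ code lo≡a hi≡b ⟩
      code a b                    ≡⟨ code≡i ⟩
      toℕ i                       ∎)
    where
    open ClampMap m a b a≤b b<1+m
    open Endpoints clampMap order contraction idempotent using (lo; hi)
    open ≡-Reasoning

  size : HasSize (suc m) (T (suc m))
  size = endpointCode , endpointCode-injective , endpointCode-surjective

corollary2p14 : (n : ℕ) → 1 ≤ n → HasSize n ((n * suc n) / 2)
corollary2p14 (suc m) _ = subst (HasSize (suc m)) (sym (n*[1+n]/2≡T (suc m))) (Count.size m)
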